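{- For every positive integer $t$ there is a constant $C=C(t)$ such that the following holds. If $G$ is a graph with maximum degree at most $\Delta$ that contains no subgraph isomorphic to $K_{t,t,t}$, then there is a linear ordering of $V(G)$ such that every vertex $u\in V(G)$ is contained in at most $3C\Delta^{2-1/t^2}$ triangles $uvw$ of $G$ in which both $v$ and $w$ precede $u$ in the ordering.
   Context: $K_{t,t,t}$ is the complete tripartite graph with three parts of size $t$; subgraphs need not be induced. -}

module Defs where

open import Level using (0ℓ)
open import Data.Nat using (ℕ; _<_; _≤_; _*_; _^_; _∸_)
open import Data.Nat.Properties using (_<?_)
open import Data.Fin using (Fin; toℕ)
open import Data.List using (List; length; filter; cartesianProduct)
open import Data.List.Base using ()
open import Data.Fin.Base using ()
open import Data.List using () renaming (map to lmap)
open import Data.Product using (Σ; _×_; _,_; proj₁; proj₂; ∃-syntax)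
open import Relation.Nullary using (¬_; Dec)
open import Relation.Nullary.Decidable using (_×-dec_)
open import Relation.Binary using (Decidable)
open import Relation.Binary.PropositionalEquality using (_≡_)
open import Function.Definitions using (Injective)
open import Data.List.Base using () renaming (tabulate to ltab)

allFin : (n : ℕ) → List (Fin n)
allFin n = ltab (λ i → i)

record Graph (n : ℕ) : Set₁ where
  field
    Adj    : Fin n → Fin n → Set
    adj?   : Decidable Adj
    sym    : ∀ {u v} → Adj u v → Adj v u
    irrefl : ∀ {u} → ¬ Adj u u
open Graph public

degree : ∀ {n} → Graph n → Fin n → ℕ
degree G v = length (filter (adj? G v) (allFin _))

-- G contains a (not necessarily induced) subgraph isomorphic to K_{t,t,t}:
-- an injective map from the vertex set Fin 3 × Fin t of K_{t,t,t} into V(G)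
-- sending vertices in different parts to adjacent vertices.
ContainsKttt : ∀ {n} → Graph n → ℕ → Set
ContainsKttt {n} G t =
  Σ (Fin 3 × Fin t → Fin n) λ f → (Injective _≡_ _≡_ f ×
          (∀ (i j : Fin 3) (a b : Fin t) → ¬ (i ≡ j) → Adj G (f (i , a)) (f (j , b))))

-- A linear ordering of V(G) given by an injective position map pos : Fin n → Fin n
-- (v precedes u iff toℕ (pos v) < toℕ (pos u)).
Precedes : ∀ {n} → (Fin n → Fin n) → Fin n → Fin n → Set
Precedes pos v u = toℕ (pos v) < toℕ (pos u)

-- Triangle uvw with v, w both preceding u (counted once per unordered pair {v,w},
-- by requiring v to precede w).
BackTri : ∀ {n} → Graph n → (Fin n → Fin n) → Fin n → Fin n × Fin n → Set
BackTri G pos u (v , w) =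
  Precedes pos v w × Precedes pos w u × Adj G u v × Adj G u w × Adj G v w

backTri? : ∀ {n} (G : Graph n) (pos : Fin n → Fin n) (u : Fin n) (p : Fin n × Fin n) → Dec (BackTri G pos u p)
backTri? G pos u (v , w) =
  (toℕ (pos v) <? toℕ (pos w)) ×-dec ((toℕ (pos w) <? toℕ (pos u)) ×-dec
  (adj? G u v ×-dec (adj? G u w ×-dec adj? G v w)))

backTriangles : ∀ {n} → Graph n → (Fin n → Fin n) → Fin n → ℕ
backTriangles {n} G pos u =
  length (filter (backTri? G pos u) (cartesianProduct (allFin n) (allFin n)))

-- Write t = s + 1, and let m be the number of non-isolated vertices and T the number of
-- ordered triangles. Since T = Σ_{vw ∈ E} codeg(v, w), Hölder's inequality gives
-- T^t ≤ (mΔ)^s Σ_{vw ∈ E} codeg(v, w)^t, and expanding codeg(v, w)^t as the number of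
-- t-tuples S with v, w ∈ N(S) turns the sum into Σ_S Σ_{v ∈ N(S)} |N(S) ∩ N(v)|.
-- Hölder once more, and expanding |N(S) ∩ N(v)|^t over t-tuples A ⊆ N(S) ∩ N(v), reduces
-- everything to the sum of |N(S) ∩ N(A)| over completely joined pairs (S, A). For
-- injective S and A this is at most s², as t distinct common neighbours would complete a
-- K_{t,t,t}; tuples with repeated entries are rare. Altogether T^{t²} ≤ 3s² m^{t²} Δ^{2t²-1}.
-- Applied to an induced subgraph on m vertices, this yields a vertex lying in at most
-- 3s² Δ^{2-1/t²} of its triangles. Removing such vertices one at a time and ordering
-- them in reverse order of removal gives the required ordering.

{-# OPTIONS --safe #-}
module Submission where

open import Data.Bool using (if_then_else_; true; false)
open import Data.Empty using (⊥; ⊥-elim)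
open import Data.Fin using (Fin; zero; suc; _≟_; toℕ; fromℕ<)
open import Data.Fin.Properties using (toℕ-fromℕ<)
open import Data.Fin.Subset using (Subset; inside; outside; _∈_; ∣_∣; _-_; ⊤; Nonempty)
open import Data.Fin.Subset.Properties
  using (_∈?_; nonempty?; ∈⊤; ∣⊤∣≡n; x∈p⇒∣p-x∣<∣p∣; x∈p∧x≢y⇒x∈p-y)
open import Data.List
  using (List; []; _∷_; [_]; _++_; map; length; filter; tabulate; cartesianProductWith; cartesianProduct)
open import Data.List.Extrema.Nat using (argmin; argmin-all; f[argmin]≤f[xs])
open import Data.List.Membership.Propositional.Properties using (∈-allFin; ∈-filter⁺)
open import Data.List.Properties using (map-tabulate)
import Data.List.Relation.Unary.All as All
open import Data.List.Relation.Unary.All.Properties using (all-filter)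
open import Data.Nat
  using (ℕ; zero; suc; _+_; _*_; _^_; _∸_; _≤_; _<_; z≤n; s≤s; z<s; >-nonZero)
open import Data.Nat.Induction using (<-wellFounded)
open import Data.Nat.Properties hiding (_≟_)
open import Data.Nat.Tactic.RingSolver using (solve-∀)
open import Data.Product using (_×_; _,_; proj₁; proj₂; uncurry; ∃-syntax)
open import Data.Sum using (inj₁; inj₂)
open import Data.Vec using (Vec; []; _∷_; lookup)
open import Function using (_∘_)
open import Function.Definitions using (Injective)
open import Induction.WellFounded using (Acc; acc)
open import Relation.Nullary using (Dec; yes; no; does; ¬_)
open import Relation.Nullary.Decidable using (_×-dec_)
open import Relation.Unary using (Decidable)
open import Relation.Binary.PropositionalEquality hiding ([_])

open import Defs renaming (sym to Adj-sym)

private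
  variable
    A B C X Y : Set
    n k : ℕ

m+m≤n+n⇒m≤n : ∀ {m n} → m + m ≤ n + n → m ≤ n
m+m≤n+n⇒m≤n {m} {n} le = *-cancelˡ-≤ 2 (subst₂ _≤_ (double m) (double n) le)
  where
  double : ∀ x → x + x ≡ 2 * x
  double = solve-∀

m*n>0⇒m>0 : ∀ m {n} → 0 < m * n → 0 < m
m*n>0⇒m>0 (suc m) _ = z<s

m*n>0⇒n>0 : ∀ m {n} → 0 < m * n → 0 < n
m*n>0⇒n>0 m {n} mn>0 = m*n>0⇒m>0 n (subst (0 <_) (*-comm m n) mn>0)

m*n≤m : ∀ m {n} → n ≤ 1 → m * n ≤ m
m*n≤m m n≤1 = ≤-trans (*-monoʳ-≤ m n≤1) (≤-reflexive (*-identityʳ m))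

m*n≤n : ∀ {m} n → m ≤ 1 → m * n ≤ n
m*n≤n n m≤1 = ≤-trans (*-monoˡ-≤ n m≤1) (≤-reflexive (+-identityʳ n))

m*m^k≤n*m^k⇒m≤n : ∀ m n k → m * m ^ k ≤ n * m ^ k → m ≤ n
m*m^k≤n*m^k⇒m≤n zero      n k _  = z≤n
m*m^k≤n*m^k⇒m≤n m@(suc _) n k le = *-cancelʳ-≤ m n (m ^ k) {{m^n≢0 m k}} le

m≤m^[1+n] : ∀ m n → m ≤ m ^ suc n
m≤m^[1+n] zero      n = z≤n
m≤m^[1+n] m@(suc _) n = m≤m*n m (m ^ n) {{m^n≢0 m n}}

^-distrib-* : ∀ a b k → (a * b) ^ k ≡ a ^ k * b ^ k
^-distrib-* a b zero    = refl
^-distrib-* a b (suc k) = trans (cong (a * b *_) (^-distrib-* a b k)) (interchange a b (a ^ k) (b ^ k))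
  where
  interchange : ∀ a b c d → a * b * (c * d) ≡ a * c * (b * d)
  interchange = solve-∀

^-rearrangement-≤ : ∀ {a b} k → a ≤ b → a * b ^ k + b * a ^ k ≤ a ^ suc k + b ^ suc k
^-rearrangement-≤ {a} k a≤b with m≤n⇒∃[o]m+o≡n a≤b
... | d , refl = begin
  a * (a + d) ^ k + (a + d) * a ^ k             ≡⟨ expand₁ a d ((a + d) ^ k) (a ^ k) ⟩
  a * a ^ k + a * (a + d) ^ k + d * a ^ k       ≤⟨ +-monoʳ-≤ _ (*-monoʳ-≤ d (^-monoˡ-≤ k (m≤m+n a d))) ⟩
  a * a ^ k + a * (a + d) ^ k + d * (a + d) ^ k ≡⟨ expand₂ a d ((a + d) ^ k) (a ^ k) ⟩
  a ^ suc k + (a + d) ^ suc k                   ∎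
  where
  open ≤-Reasoning
  expand₁ : ∀ a d X Y → a * X + (a + d) * Y ≡ a * Y + a * X + d * Y
  expand₁ = solve-∀
  expand₂ : ∀ a d X Y → a * Y + a * X + d * X ≡ a * Y + (a + d) * X
  expand₂ = solve-∀

^-rearrangement : ∀ a b k → a * b ^ k + b * a ^ k ≤ a ^ suc k + b ^ suc k
^-rearrangement a b k with ≤-total a b
... | inj₁ a≤b = ^-rearrangement-≤ k a≤b
... | inj₂ b≤a = subst₂ _≤_ (+-comm (b * a ^ k) (a * b ^ k)) (+-comm (b ^ suc k) (a ^ suc k))
                            (^-rearrangement-≤ k b≤a)

-- Finite sums and power means

∑ : List A → (A → ℕ) → ℕ
∑ []       f = 0
∑ (x ∷ xs) f = f x + ∑ xs f

infix 5 ∑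
syntax ∑ xs (λ x → e) = ∑[ x ∈ xs ] e

∑-cong : ∀ (xs : List A) {f g : A → ℕ} → (∀ x → f x ≡ g x) → ∑ xs f ≡ ∑ xs g
∑-cong []       f≗g = refl
∑-cong (x ∷ xs) f≗g = cong₂ _+_ (f≗g x) (∑-cong xs f≗g)

∑-mono-≤ : ∀ (xs : List A) {f g : A → ℕ} → (∀ x → f x ≤ g x) → ∑ xs f ≤ ∑ xs g
∑-mono-≤ []       f≤g = z≤n
∑-mono-≤ (x ∷ xs) f≤g = +-mono-≤ (f≤g x) (∑-mono-≤ xs f≤g)

∑-const : ∀ (xs : List A) c → ∑[ _ ∈ xs ] c ≡ length xs * c
∑-const []       c = refl
∑-const (x ∷ xs) c = cong (c +_) (∑-const xs c)

∑-zero : ∀ (xs : List A) → ∑[ _ ∈ xs ] 0 ≡ 0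
∑-zero xs = trans (∑-const xs 0) (*-zeroʳ (length xs))

∑-distrib-+ : ∀ (xs : List A) (f g : A → ℕ) → ∑[ x ∈ xs ] (f x + g x) ≡ ∑ xs f + ∑ xs g
∑-distrib-+ []       f g = refl
∑-distrib-+ (x ∷ xs) f g = begin
  f x + g x + (∑[ x ∈ xs ] f x + g x) ≡⟨ cong (f x + g x +_) (∑-distrib-+ xs f g) ⟩
  f x + g x + (∑ xs f + ∑ xs g)       ≡⟨ +-exchange (f x) (g x) (∑ xs f) (∑ xs g) ⟩
  f x + ∑ xs f + (g x + ∑ xs g)       ∎
  where
  open ≡-Reasoning
  +-exchange : ∀ a b c d → a + b + (c + d) ≡ a + c + (b + d)
  +-exchange = solve-∀

*-distribˡ-∑ : ∀ (xs : List A) c (f : A → ℕ) → c * ∑ xs f ≡ ∑[ x ∈ xs ] (c * f x)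
*-distribˡ-∑ []       c f = *-zeroʳ c
*-distribˡ-∑ (x ∷ xs) c f =
  trans (*-distribˡ-+ c (f x) (∑ xs f)) (cong (c * f x +_) (*-distribˡ-∑ xs c f))

*-distribʳ-∑ : ∀ (xs : List A) c (f : A → ℕ) → ∑ xs f * c ≡ ∑[ x ∈ xs ] (f x * c)
*-distribʳ-∑ xs c f =
  trans (*-comm (∑ xs f) c) (trans (*-distribˡ-∑ xs c f) (∑-cong xs (λ x → *-comm c (f x))))

∑∑-distrib-+ : ∀ (xs : List A) (ys : List B) (f g : A → B → ℕ) →
  (∑[ x ∈ xs ] ∑[ y ∈ ys ] f x y + g x y) ≡ (∑[ x ∈ xs ] ∑[ y ∈ ys ] f x y) + (∑[ x ∈ xs ] ∑[ y ∈ ys ] g x y)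
∑∑-distrib-+ xs ys f g = trans (∑-cong xs (λ x → ∑-distrib-+ ys (f x) (g x))) (∑-distrib-+ xs _ _)

∑-++ : ∀ (xs ys : List A) (f : A → ℕ) → ∑ (xs ++ ys) f ≡ ∑ xs f + ∑ ys f
∑-++ []       ys f = refl
∑-++ (x ∷ xs) ys f = trans (cong (f x +_) (∑-++ xs ys f)) (sym (+-assoc (f x) (∑ xs f) (∑ ys f)))

∑-map : ∀ (g : A → B) (xs : List A) (f : B → ℕ) → ∑ (map g xs) f ≡ ∑ xs (f ∘ g)
∑-map g []       f = refl
∑-map g (x ∷ xs) f = cong (f (g x) +_) (∑-map g xs f)

∑-comm : ∀ (xs : List A) (ys : List B) (f : A → B → ℕ) →
         ∑[ x ∈ xs ] ∑[ y ∈ ys ] f x y ≡ ∑[ y ∈ ys ] ∑[ x ∈ xs ] f x y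
∑-comm []       ys f = sym (∑-zero ys)
∑-comm (x ∷ xs) ys f = trans (cong (∑ ys (f x) +_) (∑-comm xs ys f))
                             (sym (∑-distrib-+ ys (f x) (λ y → ∑[ x ∈ xs ] f x y)))

∑-*-∑ : ∀ (xs : List A) (ys : List B) (f : A → ℕ) (g : B → ℕ) →
        ∑ xs f * ∑ ys g ≡ ∑[ x ∈ xs ] ∑[ y ∈ ys ] (f x * g y)
∑-*-∑ xs ys f g = trans (*-distribʳ-∑ xs (∑ ys g) f) (∑-cong xs (λ x → *-distribˡ-∑ ys (f x) g))

∑-cartesianProductWith : ∀ (g : A → B → C) (xs : List A) (ys : List B) (f : C → ℕ) →
  ∑ (cartesianProductWith g xs ys) f ≡ ∑[ x ∈ xs ] ∑[ y ∈ ys ] f (g x y)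
∑-cartesianProductWith g []       ys f = refl
∑-cartesianProductWith g (x ∷ xs) ys f = trans (∑-++ (map (g x) ys) _ f)
  (cong₂ _+_ (∑-map (g x) ys f) (∑-cartesianProductWith g xs ys f))

∑∑-symmetrise : ∀ (xs : List A) (F : A → A → ℕ) →
  (∑[ i ∈ xs ] ∑[ j ∈ xs ] F i j) + (∑[ i ∈ xs ] ∑[ j ∈ xs ] F i j) ≡
  (∑[ i ∈ xs ] ∑[ j ∈ xs ] F i j + F j i)
∑∑-symmetrise xs F = begin
  (∑[ i ∈ xs ] ∑[ j ∈ xs ] F i j) + (∑[ i ∈ xs ] ∑[ j ∈ xs ] F i j)
    ≡⟨ cong ((∑[ i ∈ xs ] ∑[ j ∈ xs ] F i j) +_) (∑-comm xs xs F) ⟩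
  (∑[ i ∈ xs ] ∑[ j ∈ xs ] F i j) + (∑[ i ∈ xs ] ∑[ j ∈ xs ] F j i)
    ≡⟨ ∑-distrib-+ xs _ _ ⟨
  (∑[ i ∈ xs ] (∑[ j ∈ xs ] F i j) + (∑[ j ∈ xs ] F j i))
    ≡⟨ ∑-cong xs (λ i → sym (∑-distrib-+ xs _ _)) ⟩
  (∑[ i ∈ xs ] ∑[ j ∈ xs ] F i j + F j i) ∎
  where open ≡-Reasoning

module _ (xs : List A) (w f : A → ℕ) where

  chebyshev : ∀ k → (∑[ i ∈ xs ] w i * f i) * (∑[ i ∈ xs ] w i * f i ^ k)
                    ≤ ∑ xs w * (∑[ i ∈ xs ] w i * f i ^ suc k)
  chebyshev k = m+m≤n+n⇒m≤n (begin
    L + L                                         ≡⟨ cong₂ _+_ L≡ L≡ ⟩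
    ∑∑ Lᵢⱼ + ∑∑ Lᵢⱼ                               ≡⟨ ∑∑-symmetrise xs Lᵢⱼ ⟩
    (∑[ i ∈ xs ] ∑[ j ∈ xs ] Lᵢⱼ i j + Lᵢⱼ j i)   ≤⟨ ∑-mono-≤ xs (λ i → ∑-mono-≤ xs (pointwise i)) ⟩
    (∑[ i ∈ xs ] ∑[ j ∈ xs ] Rᵢⱼ i j + Rᵢⱼ j i)   ≡⟨ ∑∑-symmetrise xs Rᵢⱼ ⟨
    ∑∑ Rᵢⱼ + ∑∑ Rᵢⱼ                               ≡⟨ cong₂ _+_ R≡ R≡ ⟨
    R + R                                         ∎)
    where
    open ≤-Reasoning
    ∑∑ : (A → A → ℕ) → ℕ
    ∑∑ F = ∑[ i ∈ xs ] ∑[ j ∈ xs ] F i j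
    L = (∑[ i ∈ xs ] w i * f i) * (∑[ i ∈ xs ] w i * f i ^ k)
    R = ∑ xs w * (∑[ i ∈ xs ] w i * f i ^ suc k)
    Lᵢⱼ Rᵢⱼ : A → A → ℕ
    Lᵢⱼ i j = w i * f i * (w j * f j ^ k)
    Rᵢⱼ i j = w i * (w j * f j ^ suc k)
    L≡ : L ≡ ∑∑ Lᵢⱼ
    L≡ = ∑-*-∑ xs xs _ _
    R≡ : R ≡ ∑∑ Rᵢⱼ
    R≡ = ∑-*-∑ xs xs _ _
    pointwise : ∀ i j → Lᵢⱼ i j + Lᵢⱼ j i ≤ Rᵢⱼ i j + Rᵢⱼ j i
    pointwise i j = begin
      Lᵢⱼ i j + Lᵢⱼ j i                           ≡⟨ factorₗ (w i) (w j) (f i) (f j) (f j ^ k) (f i ^ k) ⟩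
      w i * w j * (f i * f j ^ k + f j * f i ^ k) ≤⟨ *-monoʳ-≤ (w i * w j) (^-rearrangement (f i) (f j) k) ⟩
      w i * w j * (f i ^ suc k + f j ^ suc k)     ≡⟨ factorᵣ (w i) (w j) (f i ^ suc k) (f j ^ suc k) ⟨
      Rᵢⱼ i j + Rᵢⱼ j i                           ∎
      where
      factorₗ : ∀ wi wj fi fj X Y → wi * fi * (wj * X) + wj * fj * (wi * Y) ≡ wi * wj * (fi * X + fj * Y)
      factorₗ = solve-∀
      factorᵣ : ∀ wi wj P Q → wi * (wj * Q) + wj * (wi * P) ≡ wi * wj * (P + Q)
      factorᵣ = solve-∀

  power-mean : ∀ k → (∑[ i ∈ xs ] w i * f i) ^ suc k ≤ ∑ xs w ^ k * (∑[ i ∈ xs ] w i * f i ^ suc k)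
  power-mean zero = ≤-reflexive (begin
    (∑[ i ∈ xs ] w i * f i) * 1       ≡⟨ *-identityʳ _ ⟩
    (∑[ i ∈ xs ] w i * f i)           ≡⟨ ∑-cong xs (λ i → cong (w i *_) (*-identityʳ (f i))) ⟨
    (∑[ i ∈ xs ] w i * (f i * 1))     ≡⟨ +-identityʳ _ ⟨
    1 * (∑[ i ∈ xs ] w i * f i ^ 1)   ∎)
    where open ≡-Reasoning
  power-mean (suc k) = begin
    S * S ^ suc k            ≤⟨ *-monoʳ-≤ S (power-mean k) ⟩
    S * (W ^ k * M (suc k))  ≡⟨ x∙yz≈y∙xz S (W ^ k) (M (suc k)) ⟩
    W ^ k * (S * M (suc k))  ≤⟨ *-monoʳ-≤ (W ^ k) (chebyshev (suc k)) ⟩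
    W ^ k * (W * M (2 + k))  ≡⟨ x∙yz≈y∙xz (W ^ k) W (M (2 + k)) ⟩
    W * (W ^ k * M (2 + k))  ≡⟨ *-assoc W (W ^ k) (M (2 + k)) ⟨
    W ^ suc k * M (2 + k)    ∎
    where
    open ≤-Reasoning
    S = ∑[ i ∈ xs ] w i * f i
    W = ∑ xs w
    M : ℕ → ℕ
    M m = ∑[ i ∈ xs ] w i * f i ^ m
    x∙yz≈y∙xz : ∀ a b c → a * (b * c) ≡ b * (a * c)
    x∙yz≈y∙xz = solve-∀

power-mean₂ : ∀ (xs : List A) (ys : List B) (w f : A → B → ℕ) k →
  (∑[ x ∈ xs ] ∑[ y ∈ ys ] w x y * f x y) ^ suc k
    ≤ (∑[ x ∈ xs ] ∑[ y ∈ ys ] w x y) ^ k * (∑[ x ∈ xs ] ∑[ y ∈ ys ] w x y * f x y ^ suc k)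
power-mean₂ xs ys w f k =
  subst₂ _≤_ (cong (_^ suc k) (∑-cartesianProductWith _,_ xs ys _))
             (cong₂ (λ a b → a ^ k * b) (∑-cartesianProductWith _,_ xs ys _) (∑-cartesianProductWith _,_ xs ys _))
             (power-mean (cartesianProduct xs ys) (uncurry w) (uncurry f) k)

𝟙 : Dec X → ℕ
𝟙 d = if does d then 1 else 0

𝟙≤1 : (d : Dec X) → 𝟙 d ≤ 1
𝟙≤1 (yes _) = ≤-refl
𝟙≤1 (no _)  = z≤n

𝟙≡1 : (d : Dec X) → X → 𝟙 d ≡ 1
𝟙≡1 (yes _) _  = refl
𝟙≡1 (no ¬p) p = ⊥-elim (¬p p)

𝟙≡0 : (d : Dec X) → ¬ X → 𝟙 d ≡ 0
𝟙≡0 (yes p) ¬p = ⊥-elim (¬p p)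
𝟙≡0 (no _)  _  = refl

𝟙>0⇒witness : (d : Dec X) → 0 < 𝟙 d → X
𝟙>0⇒witness (yes p) _ = p

𝟙≤ : (d : Dec X) {m : ℕ} → (X → 0 < m) → 𝟙 d ≤ m
𝟙≤ (yes p) X⇒m>0 = X⇒m>0 p
𝟙≤ (no _)  _      = z≤n

𝟙-mono : (X → Y) → (p? : Dec X) (q? : Dec Y) → 𝟙 p? ≤ 𝟙 q?
𝟙-mono X⇒Y p? q? = 𝟙≤ p? (λ p → ≤-reflexive (sym (𝟙≡1 q? (X⇒Y p))))

length-filter≡∑𝟙 : ∀ {P : A → Set} (P? : Decidable P) xs → length (filter P? xs) ≡ ∑[ x ∈ xs ] 𝟙 (P? x)
length-filter≡∑𝟙 P? []       = refl
length-filter≡∑𝟙 P? (x ∷ xs) with does (P? x)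
... | true  = cong suc (length-filter≡∑𝟙 P? xs)
... | false = length-filter≡∑𝟙 P? xs

∑-allFin-suc : ∀ (f : Fin (suc n) → ℕ) → ∑ (allFin (suc n)) f ≡ f zero + (∑[ x ∈ allFin n ] f (suc x))
∑-allFin-suc {n} f = cong (f zero +_) (begin
  ∑ (tabulate suc) f            ≡⟨ cong (λ xs → ∑ xs f) (map-tabulate (λ x → x) suc) ⟨
  ∑ (map suc (allFin n)) f      ≡⟨ ∑-map suc (allFin n) f ⟩
  (∑[ x ∈ allFin n ] f (suc x)) ∎)
  where open ≡-Reasoning

∑-allFin-pick : ∀ (g : Fin n → ℕ) y → (∑[ x ∈ allFin n ] g x * 𝟙 (x ≟ y)) ≡ g y
∑-allFin-pick {suc n} g zero = begin
  (∑[ x ∈ allFin (suc n) ] g x * 𝟙 (x ≟ zero))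
    ≡⟨ ∑-allFin-suc (λ x → g x * 𝟙 (x ≟ zero)) ⟩
  g zero * 1 + (∑[ x ∈ allFin n ] g (suc x) * 0)
    ≡⟨ cong₂ _+_ (*-identityʳ (g zero)) (∑-cong (allFin n) (λ x → *-zeroʳ (g (suc x)))) ⟩
  g zero + (∑[ x ∈ allFin n ] 0)
    ≡⟨ cong (g zero +_) (∑-zero (allFin n)) ⟩
  g zero + 0
    ≡⟨ +-identityʳ (g zero) ⟩
  g zero ∎
  where open ≡-Reasoning
∑-allFin-pick {suc n} g (suc y) = begin
  (∑[ x ∈ allFin (suc n) ] g x * 𝟙 (x ≟ suc y))
    ≡⟨ ∑-allFin-suc (λ x → g x * 𝟙 (x ≟ suc y)) ⟩
  g zero * 0 + (∑[ x ∈ allFin n ] g (suc x) * 𝟙 (x ≟ y))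
    ≡⟨ cong (_+ (∑[ x ∈ allFin n ] g (suc x) * 𝟙 (x ≟ y))) (*-zeroʳ (g zero)) ⟩
  (∑[ x ∈ allFin n ] g (suc x) * 𝟙 (x ≟ y))
    ≡⟨ ∑-allFin-pick (g ∘ suc) y ⟩
  g (suc y) ∎
  where open ≡-Reasoning

∣p∣≡∑𝟙 : ∀ (p : Subset n) → ∣ p ∣ ≡ ∑[ x ∈ allFin n ] 𝟙 (x ∈? p)
∣p∣≡∑𝟙 []            = refl
∣p∣≡∑𝟙 (inside ∷ p)  = trans (cong suc (∣p∣≡∑𝟙 p)) (sym (∑-allFin-suc (λ x → 𝟙 (x ∈? inside ∷ p))))
∣p∣≡∑𝟙 (outside ∷ p) = trans (∣p∣≡∑𝟙 p) (sym (∑-allFin-suc (λ x → 𝟙 (x ∈? outside ∷ p))))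

tuples : List A → (k : ℕ) → List (Vec A k)
tuples xs zero    = [ [] ]
tuples xs (suc k) = cartesianProductWith _∷_ xs (tuples xs k)

∏ : Vec A k → (A → ℕ) → ℕ
∏ []      g = 1
∏ (x ∷ S) g = g x * ∏ S g

infix 5 ∏
syntax ∏ S (λ x → e) = ∏[ x ∈ S ] e

∑-tuples-∏ : ∀ (xs : List A) k (g : A → ℕ) → (∑[ S ∈ tuples xs k ] ∏ S g) ≡ ∑ xs g ^ k
∑-tuples-∏ xs zero    g = refl
∑-tuples-∏ xs (suc k) g = begin
  (∑[ S ∈ tuples xs (suc k) ] ∏ S g)
    ≡⟨ ∑-cartesianProductWith _∷_ xs (tuples xs k) (λ S → ∏ S g) ⟩
  (∑[ x ∈ xs ] ∑[ S ∈ tuples xs k ] g x * ∏ S g)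
    ≡⟨ ∑-cong xs (λ x → *-distribˡ-∑ (tuples xs k) (g x) (λ S → ∏ S g)) ⟨
  (∑[ x ∈ xs ] g x * (∑[ S ∈ tuples xs k ] ∏ S g))
    ≡⟨ *-distribʳ-∑ xs _ g ⟨
  ∑ xs g * (∑[ S ∈ tuples xs k ] ∏ S g)
    ≡⟨ cong (∑ xs g *_) (∑-tuples-∏ xs k g) ⟩
  ∑ xs g * ∑ xs g ^ k ∎
  where open ≡-Reasoning

∏-cong : ∀ (S : Vec A k) {f g : A → ℕ} → (∀ x → f x ≡ g x) → ∏ S f ≡ ∏ S g
∏-cong []      f≗g = refl
∏-cong (x ∷ S) f≗g = cong₂ _*_ (f≗g x) (∏-cong S f≗g)

∏-distrib-* : ∀ (S : Vec A k) (f g : A → ℕ) → (∏[ x ∈ S ] f x * g x) ≡ ∏ S f * ∏ S g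
∏-distrib-* []      f g = refl
∏-distrib-* (x ∷ S) f g = begin
  f x * g x * (∏[ x ∈ S ] f x * g x) ≡⟨ cong (f x * g x *_) (∏-distrib-* S f g) ⟩
  f x * g x * (∏ S f * ∏ S g)        ≡⟨ interchange (f x) (g x) (∏ S f) (∏ S g) ⟩
  f x * ∏ S f * (g x * ∏ S g)        ∎
  where
  open ≡-Reasoning
  interchange : ∀ a b c d → a * b * (c * d) ≡ a * c * (b * d)
  interchange = solve-∀

∏-one : ∀ (S : Vec A k) → (∏[ _ ∈ S ] 1) ≡ 1
∏-one []      = refl
∏-one (x ∷ S) = trans (+-identityʳ _) (∏-one S)

∏-comm : ∀ {B : Set} {l} (S : Vec A k) (T : Vec B l) (F : A → B → ℕ) →
         (∏[ b ∈ T ] ∏[ a ∈ S ] F a b) ≡ (∏[ a ∈ S ] ∏[ b ∈ T ] F a b)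
∏-comm S []      F = sym (∏-one S)
∏-comm S (b ∷ T) F = trans (cong ((∏[ a ∈ S ] F a b) *_) (∏-comm S T F))
                           (sym (∏-distrib-* S (λ a → F a b) (λ a → ∏[ b ∈ T ] F a b)))

∏≤1 : ∀ {g : A → ℕ} → (∀ x → g x ≤ 1) → (S : Vec A k) → ∏ S g ≤ 1
∏≤1 g≤1 []      = ≤-refl
∏≤1 g≤1 (x ∷ S) = *-mono-≤ (g≤1 x) (∏≤1 g≤1 S)

∏>0⇒factor>0 : ∀ (S : Vec A k) {g : A → ℕ} → 0 < ∏ S g → ∀ i → 0 < g (lookup S i)
∏>0⇒factor>0 (x ∷ S) {g} ∏>0 zero    = m*n>0⇒m>0 (g x) ∏>0
∏>0⇒factor>0 (x ∷ S) {g} ∏>0 (suc i) = ∏>0⇒factor>0 S (m*n>0⇒n>0 (g x) ∏>0) i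

multiplicity : Fin n → Vec (Fin n) k → ℕ
multiplicity x []      = 0
multiplicity x (y ∷ S) = 𝟙 (x ≟ y) + multiplicity x S

collisions : Vec (Fin n) k → ℕ
collisions []      = 0
collisions (x ∷ S) = multiplicity x S + collisions S

multiplicity≡0⇒∉ : ∀ {x : Fin n} (S : Vec (Fin n) k) → multiplicity x S ≡ 0 → ∀ i → x ≢ lookup S i
multiplicity≡0⇒∉ {x = x} (y ∷ S) m≡0 zero x≡y =
  1≢0 (trans (sym (𝟙≡1 (x ≟ y) x≡y)) (m+n≡0⇒m≡0 (𝟙 (x ≟ y)) m≡0))
  where
  1≢0 : 1 ≢ 0
  1≢0 ()
multiplicity≡0⇒∉ {x = x} (y ∷ S) m≡0 (suc i) = multiplicity≡0⇒∉ S (m+n≡0⇒n≡0 (𝟙 (x ≟ y)) m≡0) i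

collisions≡0⇒lookup-injective : ∀ (S : Vec (Fin n) k) → collisions S ≡ 0 → Injective _≡_ _≡_ (lookup S)
collisions≡0⇒lookup-injective (x ∷ S) c≡0 {zero}  {zero}  _  = refl
collisions≡0⇒lookup-injective (x ∷ S) c≡0 {zero}  {suc j} eq =
  ⊥-elim (multiplicity≡0⇒∉ S (m+n≡0⇒m≡0 _ c≡0) j eq)
collisions≡0⇒lookup-injective (x ∷ S) c≡0 {suc i} {zero}  eq =
  ⊥-elim (multiplicity≡0⇒∉ S (m+n≡0⇒m≡0 _ c≡0) i (sym eq))
collisions≡0⇒lookup-injective (x ∷ S) c≡0 {suc i} {suc j} eq =
  cong suc (collisions≡0⇒lookup-injective S (m+n≡0⇒n≡0 (multiplicity x S) c≡0) eq)

∑-multiplicity≤length : ∀ {g : Fin n → ℕ} → (∀ x → g x ≤ 1) → (S : Vec (Fin n) k) →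
                        (∑[ x ∈ allFin n ] g x * multiplicity x S) ≤ k
∑-multiplicity≤length {n} {g = g} g≤1 [] =
  ≤-reflexive (trans (∑-cong (allFin n) (λ x → *-zeroʳ (g x))) (∑-zero (allFin n)))
∑-multiplicity≤length {n} {k = suc k} {g = g} g≤1 (y ∷ S) = begin
  (∑[ x ∈ allFin n ] g x * (𝟙 (x ≟ y) + multiplicity x S))
    ≡⟨ ∑-cong (allFin n) (λ x → *-distribˡ-+ (g x) (𝟙 (x ≟ y)) (multiplicity x S)) ⟩
  (∑[ x ∈ allFin n ] g x * 𝟙 (x ≟ y) + g x * multiplicity x S)
    ≡⟨ ∑-distrib-+ (allFin n) _ _ ⟩
  (∑[ x ∈ allFin n ] g x * 𝟙 (x ≟ y)) + (∑[ x ∈ allFin n ] g x * multiplicity x S)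
    ≡⟨ cong (_+ (∑[ x ∈ allFin n ] g x * multiplicity x S)) (∑-allFin-pick g y) ⟩
  g y + (∑[ x ∈ allFin n ] g x * multiplicity x S)
    ≤⟨ +-mono-≤ (g≤1 y) (∑-multiplicity≤length g≤1 S) ⟩
  suc k ∎
  where open ≤-Reasoning

∑-collisions-step : ∀ {g : Fin n → ℕ} → (∀ x → g x ≤ 1) → ∀ s →
  (∑[ S ∈ tuples (allFin n) (2 + s) ] collisions S * ∏ S g)
    ≤ ∑ (allFin n) g ^ suc s * suc s + ∑ (allFin n) g * (∑[ S ∈ tuples (allFin n) (suc s) ] collisions S * ∏ S g)
∑-collisions-step {n} {g} g≤1 s = begin
  (∑[ S ∈ tuples V (2 + s) ] collisions S * ∏ S g)
    ≡⟨ ∑-cartesianProductWith _∷_ V T _ ⟩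
  (∑[ x ∈ V ] ∑[ S ∈ T ] (multiplicity x S + collisions S) * (g x * ∏ S g))
    ≡⟨ ∑-cong V (λ x → ∑-cong T (λ S → split (multiplicity x S) (collisions S) (g x) (∏ S g))) ⟩
  (∑[ x ∈ V ] ∑[ S ∈ T ] ∏ S g * (g x * multiplicity x S) + g x * (collisions S * ∏ S g))
    ≡⟨ ∑∑-distrib-+ V T _ _ ⟩
  (∑[ x ∈ V ] ∑[ S ∈ T ] ∏ S g * (g x * multiplicity x S)) + (∑[ x ∈ V ] ∑[ S ∈ T ] g x * (collisions S * ∏ S g))
    ≡⟨ cong₂ _+_ (∑-comm V T _) (∑-cong V (λ x → sym (*-distribˡ-∑ T (g x) _))) ⟩
  (∑[ S ∈ T ] ∑[ x ∈ V ] ∏ S g * (g x * multiplicity x S)) + (∑[ x ∈ V ] g x * N)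
    ≡⟨ cong₂ _+_ (∑-cong T (λ S → *-distribˡ-∑ V (∏ S g) _)) (*-distribʳ-∑ V N g) ⟨
  (∑[ S ∈ T ] ∏ S g * (∑[ x ∈ V ] g x * multiplicity x S)) + ℓ * N
    ≤⟨ +-monoˡ-≤ (ℓ * N) (∑-mono-≤ T (λ S → *-monoʳ-≤ (∏ S g) (∑-multiplicity≤length g≤1 S))) ⟩
  (∑[ S ∈ T ] ∏ S g * suc s) + ℓ * N
    ≡⟨ cong (_+ ℓ * N) (*-distribʳ-∑ T (suc s) (λ S → ∏ S g)) ⟨
  (∑[ S ∈ T ] ∏ S g) * suc s + ℓ * N
    ≡⟨ cong (λ x → x * suc s + ℓ * N) (∑-tuples-∏ V (suc s) g) ⟩
  ℓ ^ suc s * suc s + ℓ * N ∎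
  where
  open ≤-Reasoning
  V = allFin n
  T = tuples V (suc s)
  ℓ = ∑ V g
  N = ∑[ S ∈ T ] collisions S * ∏ S g
  split : ∀ m c a P → (m + c) * (a * P) ≡ P * (a * m) + a * (c * P)
  split = solve-∀

∑-collisions≤ : ∀ {g : Fin n → ℕ} → (∀ x → g x ≤ 1) → ∀ s →
  (∑[ S ∈ tuples (allFin n) (suc s) ] collisions S * ∏ S g) ≤ s * s * ∑ (allFin n) g ^ s
∑-collisions≤ {n} g≤1 zero =
  ≤-reflexive (trans (∑-cartesianProductWith _∷_ (allFin n) _ _) (∑-zero (allFin n)))
∑-collisions≤ {n} {g} g≤1 (suc s) = begin
  (∑[ S ∈ tuples (allFin n) (2 + s) ] collisions S * ∏ S g)
    ≤⟨ ∑-collisions-step g≤1 s ⟩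
  ℓ ^ suc s * suc s + ℓ * (∑[ S ∈ tuples (allFin n) (suc s) ] collisions S * ∏ S g)
    ≤⟨ +-monoʳ-≤ (ℓ ^ suc s * suc s) (*-monoʳ-≤ ℓ (∑-collisions≤ g≤1 s)) ⟩
  ℓ ^ suc s * suc s + ℓ * (s * s * ℓ ^ s)
    ≡⟨ collect ℓ (ℓ ^ s) s ⟩
  (s * s + suc s) * ℓ ^ suc s
    ≤⟨ *-monoˡ-≤ (ℓ ^ suc s) (m≤m+n (s * s + suc s) s) ⟩
  (s * s + suc s + s) * ℓ ^ suc s
    ≡⟨ cong (_* ℓ ^ suc s) (square s) ⟩
  suc s * suc s * ℓ ^ suc s ∎
  where
  open ≤-Reasoning
  ℓ = ∑ (allFin n) g
  collect : ∀ l L s → l * L * suc s + l * (s * s * L) ≡ (s * s + suc s) * (l * L)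
  collect = solve-∀
  square : ∀ s → s * s + suc s + s ≡ suc s * suc s
  square = solve-∀

edge : Graph n → Fin n → Fin n → ℕ
edge G x y = 𝟙 (adj? G x y)

edge≤1 : ∀ (G : Graph n) x y → edge G x y ≤ 1
edge≤1 G x y = 𝟙≤1 (adj? G x y)

edge-sym : ∀ (G : Graph n) x y → edge G x y ≡ edge G y x
edge-sym G x y with adj? G x y | adj? G y x
... | yes _   | yes _   = refl
... | no  _   | no  _   = refl
... | yes xy  | no ¬yx  = ⊥-elim (¬yx (Adj-sym G xy))
... | no ¬xy  | yes yx  = ⊥-elim (¬xy (Adj-sym G yx))

degree≡∑edge : ∀ (G : Graph n) v → degree G v ≡ ∑[ x ∈ allFin n ] edge G v x
degree≡∑edge G v = length-filter≡∑𝟙 (adj? G v) (allFin _)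

-- Ordered pairs (v, w) are counted, so every triangle at u is counted twice.
triangles-at : Graph n → Fin n → ℕ
triangles-at {n} G u = ∑[ v ∈ allFin n ] ∑[ w ∈ allFin n ] edge G u v * edge G u w * edge G v w

triangles : Graph n → ℕ
triangles {n} G = ∑[ u ∈ allFin n ] triangles-at G u

three-parts⇒ContainsKttt : ∀ {t} (G : Graph n) (X Y Z : Fin t → Fin n) →
  Injective _≡_ _≡_ X → Injective _≡_ _≡_ Y → Injective _≡_ _≡_ Z →
  (∀ a b → Adj G (X a) (Y b)) → (∀ a b → Adj G (X a) (Z b)) → (∀ a b → Adj G (Y a) (Z b)) →
  ContainsKttt G t
three-parts⇒ContainsKttt G X Y Z X-inj Y-inj Z-inj XY XZ YZ = embed , embed-injective , embed-adj
  where
  embed : Fin 3 × Fin _ → Fin _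
  embed (zero , a)           = X a
  embed (suc zero , a)       = Y a
  embed (suc (suc zero) , a) = Z a
  embed-adj : ∀ i j a b → i ≢ j → Adj G (embed (i , a)) (embed (j , b))
  embed-adj zero             zero             a b i≢j = ⊥-elim (i≢j refl)
  embed-adj zero             (suc zero)       a b _   = XY a b
  embed-adj zero             (suc (suc zero)) a b _   = XZ a b
  embed-adj (suc zero)       zero             a b _   = Adj-sym G (XY b a)
  embed-adj (suc zero)       (suc zero)       a b i≢j = ⊥-elim (i≢j refl)
  embed-adj (suc zero)       (suc (suc zero)) a b _   = YZ a b
  embed-adj (suc (suc zero)) zero             a b _   = Adj-sym G (XZ b a)
  embed-adj (suc (suc zero)) (suc zero)       a b _   = Adj-sym G (YZ b a)
  embed-adj (suc (suc zero)) (suc (suc zero)) a b i≢j = ⊥-elim (i≢j refl)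
  part-injective : ∀ i {a b} → embed (i , a) ≡ embed (i , b) → a ≡ b
  part-injective zero             = X-inj
  part-injective (suc zero)       = Y-inj
  part-injective (suc (suc zero)) = Z-inj
  embed-injective : Injective _≡_ _≡_ embed
  embed-injective {i , a} {j , b} eq with i ≟ j
  ... | yes refl = cong (i ,_) (part-injective i eq)
  ... | no i≢j   = ⊥-elim (irrefl G (subst (Adj G (embed (i , a))) (sym eq) (embed-adj i j a b i≢j)))

induced : Graph n → Subset n → Graph n
induced G p = record
  { Adj    = λ x y → x ∈ p × y ∈ p × Adj G x y
  ; adj?   = λ x y → x ∈? p ×-dec (y ∈? p ×-dec adj? G x y)
  ; sym    = λ (x∈p , y∈p , xy) → y∈p , x∈p , Adj-sym G xy
  ; irrefl = λ (_ , _ , xx) → irrefl G xx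
  }

degree-induced≤ : ∀ (G : Graph n) p v → degree (induced G p) v ≤ degree G v
degree-induced≤ {n} G p v = begin
  degree (induced G p) v
    ≡⟨ degree≡∑edge (induced G p) v ⟩
  (∑[ x ∈ allFin n ] edge (induced G p) v x)
    ≤⟨ ∑-mono-≤ (allFin n) (λ x → 𝟙-mono (λ (_ , _ , vx) → vx) (adj? (induced G p) v x) (adj? G v x)) ⟩
  (∑[ x ∈ allFin n ] edge G v x)
    ≡⟨ degree≡∑edge G v ⟨
  degree G v ∎
  where open ≤-Reasoning

ContainsKttt-induced : ∀ (G : Graph n) p {t} → ContainsKttt (induced G p) t → ContainsKttt G t
ContainsKttt-induced G p (f , f-injective , f-adj) =
  f , f-injective , λ i j a b i≢j → proj₂ (proj₂ (f-adj i j a b i≢j))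

-- Counting triangles

exponent-bookkeeping : ∀ c m Δ s →
  ((m * Δ) ^ s) ^ suc s * ((m * Δ ^ suc s) ^ s * (c * Δ ^ s * (m * Δ ^ suc s)))
    ≡ c * m ^ (suc s * suc s) * Δ ^ (2 * (suc s * suc s) ∸ 1)
exponent-bookkeeping c m Δ s = begin
  ((m * Δ) ^ s) ^ t * ((m * Δ ^ t) ^ s * (c * Δ ^ s * (m * Δ ^ t)))
    ≡⟨ regroup (((m * Δ) ^ s) ^ t) ((m * Δ ^ t) ^ s) c (Δ ^ s) (m * Δ ^ t) ⟩
  c * Δ ^ s * (((m * Δ) ^ s) ^ t * (m * Δ ^ t) ^ t)
    ≡⟨ cong (c * Δ ^ s *_) (^-distrib-* ((m * Δ) ^ s) (m * Δ ^ t) t) ⟨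
  c * Δ ^ s * ((m * Δ) ^ s * (m * Δ ^ t)) ^ t
    ≡⟨ cong (λ x → c * Δ ^ s * x ^ t) inner ⟩
  c * Δ ^ s * (m ^ t * Δ ^ (s + t)) ^ t
    ≡⟨ cong (c * Δ ^ s *_) (trans (^-distrib-* (m ^ t) (Δ ^ (s + t)) t)
                                  (cong₂ _*_ (^-*-assoc m t t) (^-*-assoc Δ (s + t) t))) ⟩
  c * Δ ^ s * (m ^ (t * t) * Δ ^ ((s + t) * t))
    ≡⟨ regroup′ c (Δ ^ s) (m ^ (t * t)) (Δ ^ ((s + t) * t)) ⟩
  c * m ^ (t * t) * (Δ ^ s * Δ ^ ((s + t) * t))
    ≡⟨ cong (c * m ^ (t * t) *_) (^-distribˡ-+-* Δ s ((s + t) * t)) ⟨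
  c * m ^ (t * t) * Δ ^ (s + (s + t) * t)
    ≡⟨ cong (λ k → c * m ^ (t * t) * Δ ^ k) exponent ⟩
  c * m ^ (t * t) * Δ ^ (2 * (t * t) ∸ 1) ∎
  where
  open ≡-Reasoning
  t = suc s
  regroup : ∀ a b c d x → a * (b * (c * d * x)) ≡ c * d * (a * (x * b))
  regroup = solve-∀
  regroup′ : ∀ c d m e → c * d * (m * e) ≡ c * m * (d * e)
  regroup′ = solve-∀
  inner : (m * Δ) ^ s * (m * Δ ^ t) ≡ m ^ t * Δ ^ (s + t)
  inner = begin
    (m * Δ) ^ s * (m * Δ ^ t)     ≡⟨ cong (_* (m * Δ ^ t)) (^-distrib-* m Δ s) ⟩
    m ^ s * Δ ^ s * (m * Δ ^ t)   ≡⟨ regroup′ (m ^ s) (Δ ^ s) m (Δ ^ t) ⟩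
    m ^ s * m * (Δ ^ s * Δ ^ t)   ≡⟨ cong₂ _*_ (*-comm m (m ^ s)) (^-distribˡ-+-* Δ s t) ⟨
    m ^ t * Δ ^ (s + t)           ∎
  exponent : s + (s + t) * t ≡ 2 * (t * t) ∸ 1
  exponent = cong (_∸ 1) (expand s)
    where
    expand : ∀ s → suc (s + (s + suc s) * suc s) ≡ 2 * (suc s * suc s)
    expand = solve-∀

-- For a t-tuple S, common S is the indicator of the common neighbourhood N(S); so
-- codeg S = |N(S)|, codegWith S v = |N(S) ∩ N(v)|, jointCodeg S A = |N(S) ∩ N(A)|, and
-- complete S A = 1 iff every entry of S is adjacent to every entry of A.
module Counting {n} (H : Graph n) (s : ℕ) where

  t : ℕ
  t = suc s

  private
    V : List (Fin n)
    V = allFin n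
    e : Fin n → Fin n → ℕ
    e = edge H

  Tuple : Set
  Tuple = Vec (Fin n) t

  Vᵗ : List Tuple
  Vᵗ = tuples V t

  common : Tuple → Fin n → ℕ
  common S y = ∏[ x ∈ S ] e x y

  codeg : Tuple → ℕ
  codeg S = ∑[ y ∈ V ] common S y

  jointCodeg : Tuple → Tuple → ℕ
  jointCodeg S A = ∑[ v ∈ V ] common S v * common A v

  complete : Tuple → Tuple → ℕ
  complete S A = ∏[ a ∈ A ] common S a

  codegWith : Tuple → Fin n → ℕ
  codegWith S v = ∑[ w ∈ V ] common S w * e v w

  pairCodeg : Fin n → Fin n → ℕ
  pairCodeg v w = ∑[ x ∈ V ] e x v * e x w

  triangles≡∑edge*pairCodeg : triangles H ≡ ∑[ v ∈ V ] ∑[ w ∈ V ] e v w * pairCodeg v w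
  triangles≡∑edge*pairCodeg = begin
    (∑[ x ∈ V ] ∑[ v ∈ V ] ∑[ w ∈ V ] e x v * e x w * e v w)  ≡⟨ ∑-comm V V _ ⟩
    (∑[ v ∈ V ] ∑[ x ∈ V ] ∑[ w ∈ V ] e x v * e x w * e v w)  ≡⟨ ∑-cong V (λ v → ∑-comm V V _) ⟩
    (∑[ v ∈ V ] ∑[ w ∈ V ] ∑[ x ∈ V ] e x v * e x w * e v w)  ≡⟨ ∑-cong V (λ v → ∑-cong V (λ w →
                                                                   trans (sym (*-distribʳ-∑ V (e v w) _))
                                                                   (*-comm (pairCodeg v w) (e v w)))) ⟩
    (∑[ v ∈ V ] ∑[ w ∈ V ] e v w * pairCodeg v w)            ∎
    where open ≡-Reasoning

  pairCodeg^ : ∀ v w → pairCodeg v w ^ t ≡ ∑[ S ∈ Vᵗ ] common S v * common S w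
  pairCodeg^ v w = begin
    pairCodeg v w ^ t                      ≡⟨ ∑-tuples-∏ V t (λ x → e x v * e x w) ⟨
    (∑[ S ∈ Vᵗ ] ∏[ x ∈ S ] e x v * e x w) ≡⟨ ∑-cong Vᵗ (λ S → ∏-distrib-* S (λ x → e x v) (λ x → e x w)) ⟩
    (∑[ S ∈ Vᵗ ] common S v * common S w)  ∎
    where open ≡-Reasoning

  ∑edge*pairCodeg^≡∑common*codegWith :
    (∑[ v ∈ V ] ∑[ w ∈ V ] e v w * pairCodeg v w ^ t)
      ≡ (∑[ S ∈ Vᵗ ] ∑[ v ∈ V ] common S v * codegWith S v)
  ∑edge*pairCodeg^≡∑common*codegWith = begin
    (∑[ v ∈ V ] ∑[ w ∈ V ] e v w * pairCodeg v w ^ t)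
      ≡⟨ ∑-cong V (λ v → ∑-cong V (λ w → trans (cong (e v w *_) (pairCodeg^ v w)) (*-distribˡ-∑ Vᵗ (e v w) _))) ⟩
    (∑[ v ∈ V ] ∑[ w ∈ V ] ∑[ S ∈ Vᵗ ] e v w * (common S v * common S w))
      ≡⟨ ∑-cong V (λ v → ∑-comm V Vᵗ _) ⟩
    (∑[ v ∈ V ] ∑[ S ∈ Vᵗ ] ∑[ w ∈ V ] e v w * (common S v * common S w))
      ≡⟨ ∑-comm V Vᵗ _ ⟩
    (∑[ S ∈ Vᵗ ] ∑[ v ∈ V ] ∑[ w ∈ V ] e v w * (common S v * common S w))
      ≡⟨ ∑-cong Vᵗ (λ S → ∑-cong V (λ v → trans (∑-cong V (λ w → rearrange (e v w) (common S v) (common S w)))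
                                                    (sym (*-distribˡ-∑ V (common S v) _)))) ⟩
    (∑[ S ∈ Vᵗ ] ∑[ v ∈ V ] common S v * codegWith S v) ∎
    where
    open ≡-Reasoning
    rearrange : ∀ a b c → a * (b * c) ≡ b * (c * a)
    rearrange = solve-∀

  codegWith^ : ∀ S v → codegWith S v ^ t ≡ ∑[ A ∈ Vᵗ ] complete S A * common A v
  codegWith^ S v = begin
    codegWith S v ^ t                               ≡⟨ ∑-tuples-∏ V t (λ a → common S a * e v a) ⟨
    (∑[ A ∈ Vᵗ ] ∏[ a ∈ A ] common S a * e v a)     ≡⟨ ∑-cong Vᵗ (λ A → ∏-distrib-* A (common S) (e v)) ⟩
    (∑[ A ∈ Vᵗ ] complete S A * (∏[ a ∈ A ] e v a)) ≡⟨ ∑-cong Vᵗ (λ A → cong (complete S A *_) (∏-cong A (edge-sym H v))) ⟩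
    (∑[ A ∈ Vᵗ ] complete S A * common A v)         ∎
    where open ≡-Reasoning

  ∑common*codegWith^≡∑complete*jointCodeg :
    (∑[ S ∈ Vᵗ ] ∑[ v ∈ V ] common S v * codegWith S v ^ t)
      ≡ (∑[ S ∈ Vᵗ ] ∑[ A ∈ Vᵗ ] complete S A * jointCodeg S A)
  ∑common*codegWith^≡∑complete*jointCodeg = ∑-cong Vᵗ (λ S → begin
    (∑[ v ∈ V ] common S v * codegWith S v ^ t)
      ≡⟨ ∑-cong V (λ v → trans (cong (common S v *_) (codegWith^ S v)) (*-distribˡ-∑ Vᵗ (common S v) _)) ⟩
    (∑[ v ∈ V ] ∑[ A ∈ Vᵗ ] common S v * (complete S A * common A v))
      ≡⟨ ∑-comm V Vᵗ _ ⟩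
    (∑[ A ∈ Vᵗ ] ∑[ v ∈ V ] common S v * (complete S A * common A v))
      ≡⟨ ∑-cong Vᵗ (λ A → trans (∑-cong V (λ v → rearrange (common S v) (complete S A) (common A v)))
                                     (sym (*-distribˡ-∑ V (complete S A) _))) ⟩
    (∑[ A ∈ Vᵗ ] complete S A * jointCodeg S A) ∎)
    where
    open ≡-Reasoning
    rearrange : ∀ a b c → a * (b * c) ≡ b * (a * c)
    rearrange = solve-∀

  ∑codeg≡∑degree^ : (∑[ S ∈ Vᵗ ] codeg S) ≡ ∑[ y ∈ V ] degree H y ^ t
  ∑codeg≡∑degree^ = trans (∑-comm Vᵗ V common) (∑-cong V (λ y → begin
    (∑[ S ∈ Vᵗ ] common S y) ≡⟨ ∑-tuples-∏ V t (λ x → e x y) ⟩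
    (∑[ x ∈ V ] e x y) ^ t   ≡⟨ cong (_^ t) (∑-cong V (λ x → edge-sym H x y)) ⟩
    (∑[ x ∈ V ] e y x) ^ t   ≡⟨ cong (_^ t) (degree≡∑edge H y) ⟨
    degree H y ^ t           ∎))
    where open ≡-Reasoning

  ∑complete≡codeg^ : ∀ S → (∑[ A ∈ Vᵗ ] complete S A) ≡ codeg S ^ t
  ∑complete≡codeg^ S = ∑-tuples-∏ V t (common S)

  complete-sym : ∀ S A → complete S A ≡ complete A S
  complete-sym S A = begin
    (∏[ a ∈ A ] ∏[ x ∈ S ] e x a)  ≡⟨ ∏-comm S A e ⟩
    (∏[ x ∈ S ] ∏[ a ∈ A ] e x a)  ≡⟨ ∏-cong S (λ x → ∏-cong A (edge-sym H x)) ⟩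
    (∏[ x ∈ S ] ∏[ a ∈ A ] e a x)  ∎
    where open ≡-Reasoning

  ∑edge≡∑degree : (∑[ v ∈ V ] ∑[ w ∈ V ] e v w) ≡ ∑[ v ∈ V ] degree H v
  ∑edge≡∑degree = ∑-cong V (λ v → sym (degree≡∑edge H v))

  common≤1 : ∀ S y → common S y ≤ 1
  common≤1 S y = ∏≤1 (λ x → edge≤1 H x y) S

  jointCodeg≤codegˡ : ∀ S A → jointCodeg S A ≤ codeg S
  jointCodeg≤codegˡ S A = ∑-mono-≤ V (λ v → m*n≤m (common S v) (common≤1 A v))

  jointCodeg≤codegʳ : ∀ S A → jointCodeg S A ≤ codeg A
  jointCodeg≤codegʳ S A = ∑-mono-≤ V (λ v → m*n≤n (common A v) (common≤1 S v))

  common>0⇒Adj : ∀ S {y} → 0 < common S y → ∀ i → Adj H (lookup S i) y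
  common>0⇒Adj S {y} common>0 i = 𝟙>0⇒witness (adj? H _ y) (∏>0⇒factor>0 S common>0 i)

  ∑complete*codeg*collisions≤ :
    (∑[ S ∈ Vᵗ ] ∑[ A ∈ Vᵗ ] complete S A * (codeg A * collisions S))
      ≤ s * s * (∑[ A ∈ Vᵗ ] codeg A ^ t)
  ∑complete*codeg*collisions≤ = begin
    (∑[ S ∈ Vᵗ ] ∑[ A ∈ Vᵗ ] complete S A * (codeg A * collisions S))
      ≡⟨ ∑-comm Vᵗ Vᵗ _ ⟩
    (∑[ A ∈ Vᵗ ] ∑[ S ∈ Vᵗ ] complete S A * (codeg A * collisions S))
      ≡⟨ ∑-cong Vᵗ (λ A → trans (∑-cong Vᵗ (λ S → rearrange A S)) (sym (*-distribˡ-∑ Vᵗ (codeg A) _))) ⟩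
    (∑[ A ∈ Vᵗ ] codeg A * (∑[ S ∈ Vᵗ ] collisions S * ∏ S (common A)))
      ≤⟨ ∑-mono-≤ Vᵗ (λ A → *-monoʳ-≤ (codeg A) (∑-collisions≤ (common≤1 A) s)) ⟩
    (∑[ A ∈ Vᵗ ] codeg A * (s * s * codeg A ^ s))
      ≡⟨ ∑-cong Vᵗ (λ A → x∙yz≈y∙xz (codeg A) (s * s) (codeg A ^ s)) ⟩
    (∑[ A ∈ Vᵗ ] s * s * codeg A ^ t)
      ≡⟨ *-distribˡ-∑ Vᵗ (s * s) (λ A → codeg A ^ t) ⟨
    s * s * (∑[ A ∈ Vᵗ ] codeg A ^ t) ∎
    where
    open ≤-Reasoning
    x∙yz≈y∙xz : ∀ a b c → a * (b * c) ≡ b * (a * c)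
    x∙yz≈y∙xz = solve-∀
    rearrange : ∀ A S → complete S A * (codeg A * collisions S) ≡ codeg A * (collisions S * ∏ S (common A))
    rearrange A S = trans (cong (_* (codeg A * collisions S)) (complete-sym S A))
                          (rotate (complete A S) (codeg A) (collisions S))
      where
      rotate : ∀ a b c → a * (b * c) ≡ b * (c * a)
      rotate = solve-∀

  ∑complete*codeg*collisions-swap :
    (∑[ S ∈ Vᵗ ] ∑[ A ∈ Vᵗ ] complete S A * (codeg S * collisions A))
      ≡ (∑[ S ∈ Vᵗ ] ∑[ A ∈ Vᵗ ] complete S A * (codeg A * collisions S))
  ∑complete*codeg*collisions-swap = trans (∑-comm Vᵗ Vᵗ _)
    (∑-cong Vᵗ (λ S → ∑-cong Vᵗ (λ A → cong (_* (codeg A * collisions S)) (complete-sym A S))))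

  module _ (Kttt-free : ¬ ContainsKttt H t) where

    no-complete-tripartite : ∀ S A B → collisions S ≡ 0 → collisions A ≡ 0 → collisions B ≡ 0 →
      0 < complete S A → 0 < (∏[ b ∈ B ] common S b * common A b) → ⊥
    no-complete-tripartite S A B S-distinct A-distinct B-distinct SA>0 B>0 = Kttt-free
      (three-parts⇒ContainsKttt H (lookup S) (lookup A) (lookup B)
        (collisions≡0⇒lookup-injective S S-distinct)
        (collisions≡0⇒lookup-injective A A-distinct)
        (collisions≡0⇒lookup-injective B B-distinct)
        (λ a b → common>0⇒Adj S (∏>0⇒factor>0 A SA>0 b) a)
        (λ a b → common>0⇒Adj S (m*n>0⇒m>0 (common S _) (∏>0⇒factor>0 B B>0 b)) a)
        (λ a b → common>0⇒Adj A (m*n>0⇒n>0 (common S _) (∏>0⇒factor>0 B B>0 b)) a))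

    -- jointCodeg S A ^ t counts the t-tuples B in N(S) ∩ N(A); an injective one would
    -- complete a K_{t,t,t} with S and A, so only tuples with collisions contribute.
    jointCodeg≤s² : ∀ S A → collisions S ≡ 0 → collisions A ≡ 0 → 0 < complete S A → jointCodeg S A ≤ s * s
    jointCodeg≤s² S A S-distinct A-distinct SA>0 = m*m^k≤n*m^k⇒m≤n (jointCodeg S A) (s * s) s (begin
      jointCodeg S A ^ t                    ≡⟨ ∑-tuples-∏ V t both ⟨
      (∑[ B ∈ Vᵗ ] ∏ B both)                ≤⟨ ∑-mono-≤ Vᵗ only-colliding-B-count ⟩
      (∑[ B ∈ Vᵗ ] collisions B * ∏ B both) ≤⟨ ∑-collisions≤ both≤1 s ⟩
      s * s * jointCodeg S A ^ s            ∎)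
      where
      open ≤-Reasoning
      both : Fin n → ℕ
      both v = common S v * common A v
      both≤1 : ∀ v → both v ≤ 1
      both≤1 v = *-mono-≤ (common≤1 S v) (common≤1 A v)
      only-colliding-B-count : ∀ B → ∏ B both ≤ collisions B * ∏ B both
      only-colliding-B-count B with collisions B in B-collisions
      ... | suc c = m≤n*m (∏ B both) (suc c)
      ... | zero with ∏ B both in ∏≡
      ...   | zero  = z≤n
      ...   | suc _ = ⊥-elim (no-complete-tripartite S A B S-distinct A-distinct B-collisions SA>0
                                (subst (0 <_) (sym ∏≡) z<s))

    -- A tuple with collisions is paid for by the trivial bound jointCodeg ≤ codeg.
    jointCodeg≤ : ∀ S A → 0 < complete S A →
                  jointCodeg S A ≤ s * s + codeg A * collisions S + codeg S * collisions A
    jointCodeg≤ S A SA>0 with collisions S in S-collisions | collisions A in A-collisions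
    ... | zero  | zero  = ≤-trans (jointCodeg≤s² S A S-collisions A-collisions SA>0)
                                  (≤-trans (m≤m+n (s * s) _) (m≤m+n _ _))
    ... | suc c | _     = ≤-trans (jointCodeg≤codegʳ S A)
                          (≤-trans (m≤m*n (codeg A) (suc c)) (≤-trans (m≤n+m _ (s * s)) (m≤m+n _ _)))
    ... | zero  | suc c = ≤-trans (jointCodeg≤codegˡ S A) (≤-trans (m≤m*n (codeg S) (suc c)) (m≤n+m _ _))

    complete*jointCodeg≤ : ∀ S A → complete S A * jointCodeg S A
                           ≤ complete S A * (s * s + codeg A * collisions S + codeg S * collisions A)
    complete*jointCodeg≤ S A with complete S A in SA
    ... | zero  = z≤n
    ... | suc c = *-monoʳ-≤ (suc c) (jointCodeg≤ S A (subst (0 <_) (sym SA) z<s))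

    ∑complete*jointCodeg≤ : (∑[ S ∈ Vᵗ ] ∑[ A ∈ Vᵗ ] complete S A * jointCodeg S A)
                            ≤ 3 * (s * s) * (∑[ S ∈ Vᵗ ] codeg S ^ t)
    ∑complete*jointCodeg≤ = begin
      (∑[ S ∈ Vᵗ ] ∑[ A ∈ Vᵗ ] complete S A * jointCodeg S A)
        ≤⟨ ∑-mono-≤ Vᵗ (λ S → ∑-mono-≤ Vᵗ (complete*jointCodeg≤ S)) ⟩
      (∑[ S ∈ Vᵗ ] ∑[ A ∈ Vᵗ ] complete S A * (s * s + codeg A * collisions S + codeg S * collisions A))
        ≡⟨ ∑-cong Vᵗ (λ S → ∑-cong Vᵗ (λ A → expand (complete S A) (s * s) _ _)) ⟩
      (∑[ S ∈ Vᵗ ] ∑[ A ∈ Vᵗ ] s * s * complete S A + complete S A * (codeg A * collisions S)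
                                                    + complete S A * (codeg S * collisions A))
        ≡⟨ trans (∑∑-distrib-+ Vᵗ Vᵗ _ _) (cong (_+ collidingʳ) (∑∑-distrib-+ Vᵗ Vᵗ _ _)) ⟩
      (∑[ S ∈ Vᵗ ] ∑[ A ∈ Vᵗ ] s * s * complete S A) + collidingˡ + collidingʳ
        ≡⟨ cong₂ (λ a b → a + collidingˡ + b) ∑s²complete≡ ∑complete*codeg*collisions-swap ⟩
      s * s * completePairs + collidingˡ + collidingˡ
        ≤⟨ +-mono-≤ (+-monoʳ-≤ (s * s * completePairs) ∑complete*codeg*collisions≤) ∑complete*codeg*collisions≤ ⟩
      s * s * completePairs + s * s * completePairs + s * s * completePairs
        ≡⟨ triple (s * s) completePairs ⟩
      3 * (s * s) * completePairs ∎
      where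
      open ≤-Reasoning
      completePairs collidingˡ collidingʳ : ℕ
      completePairs = ∑[ S ∈ Vᵗ ] codeg S ^ t
      collidingˡ    = ∑[ S ∈ Vᵗ ] ∑[ A ∈ Vᵗ ] complete S A * (codeg A * collisions S)
      collidingʳ    = ∑[ S ∈ Vᵗ ] ∑[ A ∈ Vᵗ ] complete S A * (codeg S * collisions A)
      triple : ∀ k m → k * m + k * m + k * m ≡ 3 * k * m
      triple = solve-∀
      expand : ∀ c k x y → c * (k + x + y) ≡ k * c + c * x + c * y
      expand = solve-∀
      ∑s²complete≡ : (∑[ S ∈ Vᵗ ] ∑[ A ∈ Vᵗ ] s * s * complete S A) ≡ s * s * completePairs
      ∑s²complete≡ = trans (∑-cong Vᵗ (λ S → trans (sym (*-distribˡ-∑ Vᵗ (s * s) (complete S)))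
                                                        (cong (s * s *_) (∑complete≡codeg^ S))))
                           (sym (*-distribˡ-∑ Vᵗ (s * s) (λ S → codeg S ^ t)))

  module _ {Δ} (degree≤Δ : ∀ v → degree H v ≤ Δ) where

    codeg≤Δ : ∀ S → codeg S ≤ Δ
    codeg≤Δ (x ∷ S) = begin
      (∑[ y ∈ V ] e x y * (∏[ z ∈ S ] e z y)) ≤⟨ ∑-mono-≤ V (λ y → m*n≤m (e x y) (∏≤1 (λ z → edge≤1 H z y) S)) ⟩
      (∑[ y ∈ V ] e x y)                      ≡⟨ degree≡∑edge H x ⟨
      degree H x                              ≤⟨ degree≤Δ x ⟩
      Δ                                       ∎
      where open ≤-Reasoning

    ∑codeg^≤ : (∑[ S ∈ Vᵗ ] codeg S ^ t) ≤ Δ ^ s * (∑[ S ∈ Vᵗ ] codeg S)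
    ∑codeg^≤ = begin
      (∑[ S ∈ Vᵗ ] codeg S * codeg S ^ s) ≤⟨ ∑-mono-≤ Vᵗ (λ S → *-monoʳ-≤ (codeg S) (^-monoˡ-≤ s (codeg≤Δ S))) ⟩
      (∑[ S ∈ Vᵗ ] codeg S * Δ ^ s)       ≡⟨ *-distribʳ-∑ Vᵗ (Δ ^ s) codeg ⟨
      (∑[ S ∈ Vᵗ ] codeg S) * Δ ^ s       ≡⟨ *-comm _ (Δ ^ s) ⟩
      Δ ^ s * (∑[ S ∈ Vᵗ ] codeg S)       ∎
      where open ≤-Reasoning

    module _ (p : Subset n) (p-covers : ∀ {x y} → Adj H x y → x ∈ p) where

      degree≤Δ*𝟙 : ∀ x → degree H x ≤ Δ * 𝟙 (x ∈? p)
      degree≤Δ*𝟙 x with x ∈? p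
      ... | yes _   = ≤-trans (degree≤Δ x) (≤-reflexive (sym (*-identityʳ Δ)))
      ... | no x∉p = ≤-reflexive (begin
        degree H x          ≡⟨ degree≡∑edge H x ⟩
        (∑[ y ∈ V ] e x y)  ≡⟨ ∑-cong V (λ y → 𝟙≡0 (adj? H x y) (x∉p ∘ p-covers)) ⟩
        (∑[ _ ∈ V ] 0)      ≡⟨ ∑-zero V ⟩
        0                   ≡⟨ *-zeroʳ Δ ⟨
        Δ * 0               ∎)
        where open ≡-Reasoning

      ∑degree^≤ : ∀ k → (∑[ x ∈ V ] degree H x ^ suc k) ≤ ∣ p ∣ * Δ ^ suc k
      ∑degree^≤ k = begin
        (∑[ x ∈ V ] degree H x * degree H x ^ k)
          ≤⟨ ∑-mono-≤ V (λ x → *-mono-≤ (degree≤Δ*𝟙 x) (^-monoˡ-≤ k (degree≤Δ x))) ⟩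
        (∑[ x ∈ V ] Δ * 𝟙 (x ∈? p) * Δ ^ k)
          ≡⟨ ∑-cong V (λ x → rearrange Δ (𝟙 (x ∈? p)) (Δ ^ k)) ⟩
        (∑[ x ∈ V ] 𝟙 (x ∈? p) * Δ ^ suc k)
          ≡⟨ *-distribʳ-∑ V (Δ ^ suc k) (λ x → 𝟙 (x ∈? p)) ⟨
        (∑[ x ∈ V ] 𝟙 (x ∈? p)) * Δ ^ suc k
          ≡⟨ cong (_* Δ ^ suc k) (∣p∣≡∑𝟙 p) ⟨
        ∣ p ∣ * Δ ^ suc k ∎
        where
        open ≤-Reasoning
        rearrange : ∀ a b c → a * b * c ≡ b * (a * c)
        rearrange = solve-∀

      triangles-bound : ¬ ContainsKttt H t →
        triangles H ^ (t * t) ≤ 3 * (s * s) * ∣ p ∣ ^ (t * t) * Δ ^ (2 * (t * t) ∸ 1)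
      triangles-bound Kttt-free = begin
        triangles H ^ (t * t)                                              ≡⟨ ^-*-assoc (triangles H) t t ⟨
        (triangles H ^ t) ^ t                                              ≤⟨ ^-monoˡ-≤ t T^t≤ ⟩
        ((m * Δ) ^ s * P) ^ t                                              ≡⟨ ^-distrib-* ((m * Δ) ^ s) P t ⟩
        ((m * Δ) ^ s) ^ t * P ^ t                                          ≤⟨ *-monoʳ-≤ (((m * Δ) ^ s) ^ t) P^t≤ ⟩
        ((m * Δ) ^ s) ^ t * ((m * Δ ^ t) ^ s * (c * Δ ^ s * (m * Δ ^ t))) ≡⟨ exponent-bookkeeping c m Δ s ⟩
        c * m ^ (t * t) * Δ ^ (2 * (t * t) ∸ 1)                            ∎
        where
        open ≤-Reasoning
        m = ∣ p ∣
        c = 3 * (s * s)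
        E = ∑[ v ∈ V ] ∑[ w ∈ V ] e v w
        P = ∑[ v ∈ V ] ∑[ w ∈ V ] e v w * pairCodeg v w ^ t
        M = ∑[ S ∈ Vᵗ ] codeg S
        Z = ∑[ S ∈ Vᵗ ] ∑[ v ∈ V ] common S v * codegWith S v ^ t
        E≤ : E ≤ m * Δ
        E≤ = begin
          E                             ≡⟨ ∑edge≡∑degree ⟩
          (∑[ v ∈ V ] degree H v)       ≡⟨ ∑-cong V (λ v → *-identityʳ (degree H v)) ⟨
          (∑[ v ∈ V ] degree H v ^ 1)   ≤⟨ ∑degree^≤ 0 ⟩
          m * Δ ^ 1                     ≡⟨ cong (m *_) (*-identityʳ Δ) ⟩
          m * Δ                         ∎
        M≤ : M ≤ m * Δ ^ t
        M≤ = ≤-trans (≤-reflexive ∑codeg≡∑degree^) (∑degree^≤ s)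
        Z≤ : Z ≤ c * Δ ^ s * (m * Δ ^ t)
        Z≤ = begin
          Z                                                       ≡⟨ ∑common*codegWith^≡∑complete*jointCodeg ⟩
          (∑[ S ∈ Vᵗ ] ∑[ A ∈ Vᵗ ] complete S A * jointCodeg S A) ≤⟨ ∑complete*jointCodeg≤ Kttt-free ⟩
          c * (∑[ S ∈ Vᵗ ] codeg S ^ t)                           ≤⟨ *-monoʳ-≤ c (≤-trans ∑codeg^≤ (*-monoʳ-≤ (Δ ^ s) M≤)) ⟩
          c * (Δ ^ s * (m * Δ ^ t))                               ≡⟨ *-assoc c (Δ ^ s) _ ⟨
          c * Δ ^ s * (m * Δ ^ t)                                 ∎
        T^t≤ : triangles H ^ t ≤ (m * Δ) ^ s * P
        T^t≤ = begin
          triangles H ^ t                                   ≡⟨ cong (_^ t) triangles≡∑edge*pairCodeg ⟩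
          (∑[ v ∈ V ] ∑[ w ∈ V ] e v w * pairCodeg v w) ^ t ≤⟨ power-mean₂ V V e pairCodeg s ⟩
          E ^ s * P                                         ≤⟨ *-monoˡ-≤ P (^-monoˡ-≤ s E≤) ⟩
          (m * Δ) ^ s * P                                   ∎
        P^t≤ : P ^ t ≤ (m * Δ ^ t) ^ s * (c * Δ ^ s * (m * Δ ^ t))
        P^t≤ = begin
          P ^ t                                                   ≡⟨ cong (_^ t) ∑edge*pairCodeg^≡∑common*codegWith ⟩
          (∑[ S ∈ Vᵗ ] ∑[ v ∈ V ] common S v * codegWith S v) ^ t ≤⟨ power-mean₂ Vᵗ V common codegWith s ⟩
          M ^ s * Z                                               ≤⟨ *-mono-≤ (^-monoˡ-≤ s M≤) Z≤ ⟩
          (m * Δ ^ t) ^ s * (c * Δ ^ s * (m * Δ ^ t))             ∎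

-- Degeneracy orderings

module DegeneracyOrder {n} (Good : Subset n → Fin n → Set)
                       (good-exists : ∀ p → Nonempty p → ∃[ u ] (u ∈ p × Good p u)) where

  record Ranking (p : Subset n) : Set where
    field
      rank           : Fin n → ℕ
      rank<∣p∣       : ∀ {x} → x ∈ p → rank x < ∣ p ∣
      rank-injective : ∀ {x y} → x ∈ p → y ∈ p → rank x ≡ rank y → x ≡ y
      good-past      : ∀ {x} → x ∈ p →
                       ∃[ q ] (x ∈ q × (∀ {v} → v ∈ p → rank v < rank x → v ∈ q) × Good q x)

  -- A good vertex u of p is ranked after all of p - u, so its predecessors all lie in p.
  ranking : ∀ p → Ranking p
  ranking p = go p (<-wellFounded ∣ p ∣)
    where
    go : ∀ p → Acc _<_ ∣ p ∣ → Ranking p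
    go p (acc smaller) with nonempty? p
    ... | no empty = record
      { rank           = λ _ → 0
      ; rank<∣p∣       = λ x∈p → ⊥-elim (empty (_ , x∈p))
      ; rank-injective = λ x∈p _ _ → ⊥-elim (empty (_ , x∈p))
      ; good-past      = λ x∈p → ⊥-elim (empty (_ , x∈p))
      }
    ... | yes nonempty with good-exists p nonempty
    ... | u , u∈p , good-u = record
      { rank           = rank
      ; rank<∣p∣       = rank<∣p∣
      ; rank-injective = rank-injective
      ; good-past      = good-past
      }
      where
      rest : Ranking (p - u)
      rest = go (p - u) (smaller (x∈p⇒∣p-x∣<∣p∣ u∈p))
      module R = Ranking rest

      rank : Fin n → ℕ
      rank x with x ≟ u
      ... | yes _ = ∣ p - u ∣
      ... | no  _ = R.rank x

      rest< : ∀ {x} → x ∈ p → x ≢ u → R.rank x < ∣ p - u ∣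
      rest< x∈p x≢u = R.rank<∣p∣ (x∈p∧x≢y⇒x∈p-y x∈p x≢u)

      rank<∣p∣ : ∀ {x} → x ∈ p → rank x < ∣ p ∣
      rank<∣p∣ {x} x∈p with x ≟ u
      ... | yes _   = x∈p⇒∣p-x∣<∣p∣ u∈p
      ... | no  x≢u = <-trans (rest< x∈p x≢u) (x∈p⇒∣p-x∣<∣p∣ u∈p)

      rank-injective : ∀ {x y} → x ∈ p → y ∈ p → rank x ≡ rank y → x ≡ y
      rank-injective {x} {y} x∈p y∈p eq with x ≟ u | y ≟ u
      ... | yes refl | yes refl = refl
      ... | yes _    | no  y≢u  = ⊥-elim (<-irrefl (sym eq) (rest< y∈p y≢u))
      ... | no  x≢u  | yes _    = ⊥-elim (<-irrefl eq (rest< x∈p x≢u))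
      ... | no  x≢u  | no  y≢u  =
        R.rank-injective (x∈p∧x≢y⇒x∈p-y x∈p x≢u) (x∈p∧x≢y⇒x∈p-y y∈p y≢u) eq

      good-past : ∀ {x} → x ∈ p → ∃[ q ] (x ∈ q × (∀ {v} → v ∈ p → rank v < rank x → v ∈ q) × Good q x)
      good-past {x} x∈p with x ≟ u
      ... | yes refl = p , x∈p , (λ v∈p _ → v∈p) , good-u
      ... | no  x≢u with R.good-past (x∈p∧x≢y⇒x∈p-y x∈p x≢u)
      ...   | q , x∈q , past , good-x = q , x∈q , earlier , good-x
        where
        earlier : ∀ {v} → v ∈ p → rank v < R.rank x → v ∈ q
        earlier {v} v∈p v<x with v ≟ u
        ... | yes _   = ⊥-elim (<-asym v<x (rest< x∈p x≢u))
        ... | no  v≢u = past (x∈p∧x≢y⇒x∈p-y v∈p v≢u) v<x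

∃-below-average : ∀ (p : Subset n) (f : Fin n → ℕ) → Nonempty p →
                  ∃[ u ] (u ∈ p × ∣ p ∣ * f u ≤ ∑[ x ∈ allFin n ] f x)
∃-below-average {n} p f (u₀ , u₀∈p) = u , u∈p , (begin
  ∣ p ∣ * f u                           ≡⟨ cong (_* f u) (∣p∣≡∑𝟙 p) ⟩
  (∑[ x ∈ allFin n ] 𝟙 (x ∈? p)) * f u  ≡⟨ *-distribʳ-∑ (allFin n) (f u) (λ x → 𝟙 (x ∈? p)) ⟩
  (∑[ x ∈ allFin n ] 𝟙 (x ∈? p) * f u)  ≤⟨ ∑-mono-≤ (allFin n) minimal ⟩
  (∑[ x ∈ allFin n ] f x)               ∎)
  where
  open ≤-Reasoning
  members = filter (_∈? p) (allFin n)
  u = argmin f u₀ members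
  u∈p : u ∈ p
  u∈p = argmin-all f u₀∈p (all-filter (_∈? p) (allFin n))
  minimal : ∀ x → 𝟙 (x ∈? p) * f u ≤ f x
  minimal x with x ∈? p
  ... | yes x∈p = ≤-trans (≤-reflexive (+-identityʳ (f u)))
                          (All.lookup (f[argmin]≤f[xs] u₀ members) (∈-filter⁺ (_∈? p) (∈-allFin x) x∈p))
  ... | no  _   = z≤n

backTriangles≤triangles-at : ∀ (G : Graph n) pos u (q : Subset n) → u ∈ q → (∀ {v} → Precedes pos v u → v ∈ q) →
                             backTriangles G pos u ≤ triangles-at (induced G q) u
backTriangles≤triangles-at {n} G pos u q u∈q earlier⇒∈q = begin
  backTriangles G pos u
    ≡⟨ length-filter≡∑𝟙 (backTri? G pos u) (cartesianProduct V V) ⟩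
  (∑[ vw ∈ cartesianProduct V V ] 𝟙 (backTri? G pos u vw))
    ≡⟨ ∑-cartesianProductWith _,_ V V _ ⟩
  (∑[ v ∈ V ] ∑[ w ∈ V ] 𝟙 (backTri? G pos u (v , w)))
    ≤⟨ ∑-mono-≤ V (λ v → ∑-mono-≤ V (λ w → 𝟙≤ (backTri? G pos u (v , w)) (triangle-in-H v w))) ⟩
  triangles-at H u ∎
  where
  open ≤-Reasoning
  V = allFin n
  H = induced G q
  triangle-in-H : ∀ v w → BackTri G pos u (v , w) → 0 < edge H u v * edge H u w * edge H v w
  triangle-in-H v w (v<w , w<u , uv , uw , vw) = ≤-reflexive (sym (cong₂ _*_
    (cong₂ _*_ (𝟙≡1 (adj? H u v) (u∈q , v∈q , uv)) (𝟙≡1 (adj? H u w) (u∈q , w∈q , uw)))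
    (𝟙≡1 (adj? H v w) (v∈q , w∈q , vw))))
    where
    v∈q = earlier⇒∈q (<-trans v<w w<u)
    w∈q = earlier⇒∈q w<u

module _ {n} (G : Graph n) {Δ} (degree≤Δ : ∀ v → degree G v ≤ Δ) (s : ℕ)
         (Kttt-free : ¬ ContainsKttt G (suc s)) where

  private
    t c ex : ℕ
    t  = suc s
    c  = 3 * (s * s)
    ex = 2 * (t * t) ∸ 1

  Sparse : Subset n → Fin n → Set
  Sparse q u = triangles-at (induced G q) u ^ (t * t) ≤ c ^ (t * t) * Δ ^ ex

  sparse-vertex-exists : ∀ q → Nonempty q → ∃[ u ] (u ∈ q × Sparse q u)
  sparse-vertex-exists q nonempty@(_ , x∈q) with ∃-below-average q (triangles-at (induced G q)) nonempty
  ... | u , u∈q , below-average = u , u∈q , ≤-trans few (*-monoˡ-≤ (Δ ^ ex) (m≤m^[1+n] c (s + s * t)))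
    where
    H = induced G q
    H-degree≤Δ : ∀ v → degree H v ≤ Δ
    H-degree≤Δ v = ≤-trans (degree-induced≤ G q v) (degree≤Δ v)
    H-Kttt-free : ¬ ContainsKttt H t
    H-Kttt-free = Kttt-free ∘ ContainsKttt-induced G q
    ∣q∣>0 : 0 < ∣ q ∣
    ∣q∣>0 = ≤-trans (s≤s z≤n) (x∈p⇒∣p-x∣<∣p∣ x∈q)
    x∙y∙z≈y∙x∙z : ∀ a b d → a * b * d ≡ b * (a * d)
    x∙y∙z≈y∙x∙z = solve-∀
    few : triangles-at H u ^ (t * t) ≤ c * Δ ^ ex
    few = *-cancelˡ-≤ (∣ q ∣ ^ (t * t)) {{m^n≢0 ∣ q ∣ (t * t) {{>-nonZero ∣q∣>0}}}} (begin
      ∣ q ∣ ^ (t * t) * triangles-at H u ^ (t * t) ≡⟨ ^-distrib-* ∣ q ∣ (triangles-at H u) (t * t) ⟨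
      (∣ q ∣ * triangles-at H u) ^ (t * t)         ≤⟨ ^-monoˡ-≤ (t * t) below-average ⟩
      triangles H ^ (t * t)                        ≤⟨ Counting.triangles-bound H s H-degree≤Δ q proj₁ H-Kttt-free ⟩
      c * ∣ q ∣ ^ (t * t) * Δ ^ ex                 ≡⟨ x∙y∙z≈y∙x∙z c (∣ q ∣ ^ (t * t)) (Δ ^ ex) ⟩
      ∣ q ∣ ^ (t * t) * (c * Δ ^ ex)               ∎)
      where open ≤-Reasoning

  degeneracy-ordering : ∃[ pos ] (Injective _≡_ _≡_ pos × (∀ u → backTriangles G pos u ^ (t * t) ≤ c ^ (t * t) * Δ ^ ex))
  degeneracy-ordering = pos , pos-injective , few-back-triangles
    where
    open DegeneracyOrder Sparse sparse-vertex-exists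
    open Ranking (ranking ⊤)
    rank<n : ∀ x → rank x < n
    rank<n x = subst (rank x <_) (∣⊤∣≡n n) (rank<∣p∣ ∈⊤)
    pos : Fin n → Fin n
    pos x = fromℕ< (rank<n x)
    toℕ-pos : ∀ x → toℕ (pos x) ≡ rank x
    toℕ-pos x = toℕ-fromℕ< (rank<n x)
    pos-injective : Injective _≡_ _≡_ pos
    pos-injective {x} {y} eq = rank-injective ∈⊤ ∈⊤ (trans (sym (toℕ-pos x)) (trans (cong toℕ eq) (toℕ-pos y)))
    few-back-triangles : ∀ u → backTriangles G pos u ^ (t * t) ≤ c ^ (t * t) * Δ ^ ex
    few-back-triangles u with good-past ∈⊤
    ... | q , u∈q , earlier⇒∈q , sparse =
      ≤-trans (^-monoˡ-≤ (t * t) (backTriangles≤triangles-at G pos u q u∈q precedes⇒∈q)) sparse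
      where
      precedes⇒∈q : ∀ {v} → Precedes pos v u → v ∈ q
      precedes⇒∈q {v} v<u = earlier⇒∈q ∈⊤ (subst₂ _<_ (toℕ-pos v) (toℕ-pos u) v<u)

lemma3p2 : (t : ℕ) → 1 ≤ t → ∃[ C ] ((n : ℕ) (G : Graph n) (Δ : ℕ) →
             (∀ v → degree G v ≤ Δ) → ¬ ContainsKttt G t →
             ∃[ pos ] (Injective _≡_ _≡_ pos ×
               (∀ (u : Fin n) → backTriangles G pos u ^ (t * t)
                   ≤ (3 * C) ^ (t * t) * Δ ^ (2 * (t * t) ∸ 1))))
lemma3p2 (suc s) _ = s * s , λ n G Δ degree≤Δ Kttt-free → degeneracy-ordering G degree≤Δ s Kttt-free
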